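{- Let $(G,u)$ be an instance on node set $V$ with $n=|V|$, let $(G',u')$ be an admissible extension of $(G,u)$, and let $0\le\varepsilon'\le\varepsilon/2$. Let $f$ be an $\varepsilon$-optimal flow in $(G,u)$ and $f'$ an $\varepsilon'$-optimal flow in $(G',u')$ such that $|f_e-f_{\overleftarrow{e}}-f'_e+f'_{\overleftarrow{e}}|\le 2n\varepsilon$ for all $e\in E(G)$. Then $E_{\rm abd}(f,\varepsilon)\subseteq E_{\rm abd}(f',\varepsilon')$.
   Context: An instance $(G,u)$: directed graph $G=(V,E)$ (parallel arcs allowed), source $s$, sink $t$, capacities $u\in[0,\infty]^E$, symmetric arc set (each arc $e=(i,j)$ has a designated reverse $\overleftarrow{e}=(j,i)\in E$). A flow $f$ satisfies $0\le f\le u$ and conservation at nodes other than $s,t$; $\mathrm{val}(f)$ is the net outflow of $s$; $\nu(G,u)$ is the maximum flow value; $f$ is $\varepsilon$-optimal if $\mathrm{val}(f)\ge\nu(G,u)-\varepsilon$. Residual capacities: $u^f_e=u_e-f_e+f_{\overleftarrow{e}}$. With $\Gamma=4n^2$, the set of $(f,\varepsilon)$-abundant arcs is $E_{\rm abd}(f,\varepsilon)=\{e\in E: u^f_e\ge\Gamma\varepsilon\}$ (computed in the instance where $f$ lives). An $s$–$t$ cut is a set $S\subseteq V$ with $s\in S$, $t\notin S$; it is a minimum cut if it minimizes the total capacity of arcs leaving $S$. For arc sets $F_{\rm one},F_{\rm two}\subseteq V\times V$, $(G,u)\oplus(F_{\rm one},F_{\rm two})$ is the instance on $V$ obtained by adding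 (as a multiset union) the arcs of $F_{\rm one}$ with capacity $\infty$ together with their reverses with capacity $0$, and the arcs of $F_{\rm two}$ together with their reverses, all with capacity $\infty$; other capacities are unchanged. It is an admissible extension of $(G,u)$ if no arc of $F_{\rm one}\cup F_{\rm two}\cup\overleftarrow{F_{\rm two}}$ leaves any minimum $s$–$t$ cut of $(G,u)$.
   Formalization: The flows $f$ and $f'$, the finite capacities and the parameters ε and ε′ are rational. -}

module Defs where

open import Data.Nat as ℕ using (ℕ; zero; suc)
open import Data.Integer using (+_)
open import Data.Rational using (ℚ; 0ℚ; _+_; _-_; _*_; _≤_; _/_)
open import Data.Fin using (Fin; zero; suc; splitAt; _↑ˡ_; _↑ʳ_; _≟_)
open import Data.Bool using (Bool; true; false)
open import Data.Product using (_×_; _,_; proj₁; proj₂; Σ; swap)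
open import Data.Sum using (_⊎_; inj₁; inj₂)
open import Relation.Nullary using (¬_; yes; no)
open import Relation.Binary.PropositionalEquality using (_≡_; _≢_)

data Ext : Set where
  fin : ℚ → Ext
  ∞   : Ext

data _≤ₑ_ : Ext → Ext → Set where
  fin≤fin : ∀ {x y} → x ≤ y → fin x ≤ₑ fin y
  _≤∞     : ∀ (a : Ext) → a ≤ₑ ∞

_+ₑ_ : Ext → Ext → Ext
fin x +ₑ fin y = fin (x + y)
fin _ +ₑ ∞     = ∞
∞     +ₑ _     = ∞

_⊕_ : Ext → ℚ → Ext
fin x ⊕ q = fin (x + q)
∞     ⊕ q = ∞

ℕ→ℚ : ℕ → ℚ
ℕ→ℚ k = + k / 1

sumℚ : ∀ {m} → (Fin m → ℚ) → ℚ
sumℚ {zero}  g = 0ℚ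
sumℚ {suc m} g = g zero + sumℚ (λ i → g (suc i))

sumₑ : ∀ {m} → (Fin m → Ext) → Ext
sumₑ {zero}  g = fin 0ℚ
sumₑ {suc m} g = g zero +ₑ sumₑ (λ i → g (suc i))

-- Instances: node set V = Fin n, arc set E = Fin m (parallel arcs allowed)

record Instance (n : ℕ) : Set where
  field
    m    : ℕ
    tl   : Fin m → Fin n
    hd   : Fin m → Fin n
    rev  : Fin m → Fin m
    cap  : Fin m → Ext
    s    : Fin n
    t    : Fin n
open Instance public

record WellFormed {n : ℕ} (G : Instance n) : Set where
  field
    rev-invol : ∀ e → rev G (rev G e) ≡ e
    tl-rev    : ∀ e → tl G (rev G e) ≡ hd G e
    hd-rev    : ∀ e → hd G (rev G e) ≡ tl G e
    cap-nonneg : ∀ e → fin 0ℚ ≤ₑ cap G e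
    s≢t       : s G ≢ t G

Arc : ∀ {n} → Instance n → Set
Arc G = Fin (m G)

Assignment : ∀ {n} → Instance n → Set
Assignment G = Arc G → ℚ

[_]? : ∀ {n} → (Fin n × Fin n) → ℚ → ℚ
[ (a , b) ]? q with a ≟ b
... | yes _ = q
... | no  _ = 0ℚ

inflow outflow : ∀ {n} (G : Instance n) → Assignment G → Fin n → ℚ
inflow  G f v = sumℚ (λ e → [ (hd G e , v) ]? (f e))
outflow G f v = sumℚ (λ e → [ (tl G e , v) ]? (f e))

record IsFlow {n} (G : Instance n) (f : Assignment G) : Set where
  field
    nonneg   : ∀ e → 0ℚ ≤ f e
    capacity : ∀ e → fin (f e) ≤ₑ cap G e
    conserve : ∀ v → v ≢ s G → v ≢ t G → inflow G f v ≡ outflow G f v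

val : ∀ {n} (G : Instance n) → Assignment G → ℚ
val G f = outflow G f (s G) - inflow G f (s G)

IsMaxFlowValue : ∀ {n} (G : Instance n) → ℚ → Set
IsMaxFlowValue G ν =
  Σ (Assignment G) (λ g → IsFlow G g × val G g ≡ ν)
  × (∀ g → IsFlow G g → val G g ≤ ν)

EpsOptimal : ∀ {n} (G : Instance n) → Assignment G → ℚ → Set
EpsOptimal G f ε =
  IsFlow G f × Σ ℚ (λ ν → IsMaxFlowValue G ν × ν - ε ≤ val G f)

resid : ∀ {n} (G : Instance n) → Assignment G → Arc G → Ext
resid G f e = cap G e ⊕ (f (rev G e) - f e)

Γ : ℕ → ℚ
Γ n = ℕ→ℚ (4 ℕ.* n ℕ.* n)

Abundant : ∀ {n} (G : Instance n) → Assignment G → ℚ → Arc G → Set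
Abundant {n} G f ε e = fin (Γ n * ε) ≤ₑ resid G f e

Leaves : ∀ {n} → (Fin n → Bool) → Fin n × Fin n → Set
Leaves S (i , j) = (S i ≡ true) × (S j ≡ false)

IsCut : ∀ {n} (G : Instance n) → (Fin n → Bool) → Set
IsCut G S = (S (s G) ≡ true) × (S (t G) ≡ false)

cutCap : ∀ {n} (G : Instance n) → (Fin n → Bool) → Ext
cutCap G S = sumₑ (λ e → out (S (tl G e)) (S (hd G e)) (cap G e))
  where
  out : Bool → Bool → Ext → Ext
  out true false c = c
  out _    _     _ = fin 0ℚ

IsMinCut : ∀ {n} (G : Instance n) → (Fin n → Bool) → Set
IsMinCut G S = IsCut G S × (∀ T → IsCut G T → cutCap G S ≤ₑ cutCap G T)

-- Extension (G,u) ⊕ (F_one, F_two)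
-- F_one, F_two are finite families (multisets) of node pairs.
-- Arc layout of the extension: Fin (m + ((k₁ + k₁) + (k₂ + k₂))):
--   first m      : original arcs e ↦ e ↑ˡ _
--   next  k₁      : arcs of F_one (capacity ∞)
--   next  k₁      : their reverses (capacity 0)
--   next  k₂      : arcs of F_two (capacity ∞)
--   next  k₂      : their reverses (capacity ∞)

module _ {n : ℕ} (G : Instance n) {k₁ k₂ : ℕ}
         (F₁ : Fin k₁ → Fin n × Fin n) (F₂ : Fin k₂ → Fin n × Fin n) where

  private
    M = m G
    K = (k₁ ℕ.+ k₁) ℕ.+ (k₂ ℕ.+ k₂)

  data Kind : Set where
    old    : Fin M → Kind
    one    : Fin k₁ → Kind
    oneRev : Fin k₁ → Kind
    two    : Fin k₂ → Kind
    twoRev : Fin k₂ → Kind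

  kind : Fin (M ℕ.+ K) → Kind
  kind x with splitAt M x
  ... | inj₁ e = old e
  ... | inj₂ y with splitAt (k₁ ℕ.+ k₁) y
  ... | inj₁ z with splitAt k₁ z
  ... | inj₁ a = one a
  ... | inj₂ a = oneRev a
  kind x | inj₂ y | inj₂ z with splitAt k₂ z
  ... | inj₁ a = two a
  ... | inj₂ a = twoRev a

  embed : Kind → Fin (M ℕ.+ K)
  embed (old e)    = e ↑ˡ K
  embed (one a)    = M ↑ʳ ((a ↑ˡ k₁) ↑ˡ (k₂ ℕ.+ k₂))
  embed (oneRev a) = M ↑ʳ ((k₁ ↑ʳ a) ↑ˡ (k₂ ℕ.+ k₂))
  embed (two a)    = M ↑ʳ ((k₁ ℕ.+ k₁) ↑ʳ (a ↑ˡ k₂))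
  embed (twoRev a) = M ↑ʳ ((k₁ ℕ.+ k₁) ↑ʳ (k₂ ↑ʳ a))

  ktl khd : Kind → Fin n
  ktl (old e)    = tl G e
  ktl (one a)    = proj₁ (F₁ a)
  ktl (oneRev a) = proj₂ (F₁ a)
  ktl (two a)    = proj₁ (F₂ a)
  ktl (twoRev a) = proj₂ (F₂ a)
  khd (old e)    = hd G e
  khd (one a)    = proj₂ (F₁ a)
  khd (oneRev a) = proj₁ (F₁ a)
  khd (two a)    = proj₂ (F₂ a)
  khd (twoRev a) = proj₁ (F₂ a)

  krev : Kind → Kind
  krev (old e)    = old (rev G e)
  krev (one a)    = oneRev a
  krev (oneRev a) = one a
  krev (two a)    = twoRev a
  krev (twoRev a) = two a

  kcap : Kind → Ext
  kcap (old e)    = cap G e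
  kcap (one a)    = ∞
  kcap (oneRev a) = fin 0ℚ
  kcap (two a)    = ∞
  kcap (twoRev a) = ∞

  extend : Instance n
  extend = record
    { m   = M ℕ.+ K
    ; tl  = λ x → ktl (kind x)
    ; hd  = λ x → khd (kind x)
    ; rev = λ x → embed (krev (kind x))
    ; cap = λ x → kcap (kind x)
    ; s   = s G
    ; t   = t G
    }

  oldArc : Arc G → Arc extend
  oldArc e = e ↑ˡ K

  Admissible : Set
  Admissible = ∀ S → IsMinCut G S →
      (∀ a → ¬ Leaves S (F₁ a))
    × (∀ a → ¬ Leaves S (F₂ a))
    × (∀ a → ¬ Leaves S (swap (F₂ a)))

{-# OPTIONS --safe #-}
-- Only the closeness of the net flows matters.  The residual capacity of an old arc changes exactly by
-- the change of its net flow, hence by at most 2nε, and Γε − 2nε ≥ Γε/2 ≥ Γε′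
-- because 2n ≤ 2n² = Γ/2.
module Submission where

open import Defs
open import Data.Nat using (ℕ)
open import Data.Fin using (Fin)
open import Data.Product using (_×_)
open import Data.Rational using (ℚ; 0ℚ; _≤_; _+_; _-_; _*_; ½; ∣_∣)

import Data.Nat as ℕ
import Data.Nat.Properties as ℕ
open import Data.Nat.Tactic.RingSolver using (solve-∀)
import Data.Nat.Coprimality as Coprimality
open import Data.Integer as ℤ using (+_; -[1+_])
import Data.Integer.Properties as ℤ
open import Data.Rational using (mkℚ; -_; toℚᵘ; *≤*; NonNegative; nonNegative)
open import Data.Rational.Properties
import Data.Rational.Unnormalised as ℚᵘ
import Data.Rational.Unnormalised.Properties as ℚᵘ
open import Data.Rational.Solver using (module +-*-Solver)
open import Data.Fin.Properties using (splitAt-↑ˡ)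
open import Relation.Binary.PropositionalEquality

open +-*-Solver

ℕ→ℚ≡mkℚ : ∀ k → ℕ→ℚ k ≡ mkℚ (+ k) 0 (Coprimality.sym (Coprimality.1-coprimeTo k))
ℕ→ℚ≡mkℚ k = normalize-coprime (Coprimality.sym (Coprimality.1-coprimeTo k))

ℕ→ℚ-mono-≤ : ∀ {a b} → a ℕ.≤ b → ℕ→ℚ a ≤ ℕ→ℚ b
ℕ→ℚ-mono-≤ {a} {b} a≤b rewrite ℕ→ℚ≡mkℚ a | ℕ→ℚ≡mkℚ b =
  *≤* (ℤ.*-monoʳ-≤-nonNeg (+ 1) (ℤ.+≤+ a≤b))

ℕ→ℚ-homo-+ : ∀ a b → ℕ→ℚ (a ℕ.+ b) ≡ ℕ→ℚ a + ℕ→ℚ b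
ℕ→ℚ-homo-+ a b = toℚᵘ-injective (begin
  toℚᵘ (ℕ→ℚ (a ℕ.+ b))                  ≈⟨ toℚᵘ-ℕ→ℚ (a ℕ.+ b) ⟩
  ℚᵘ.mkℚᵘ (+ (a ℕ.+ b)) 0               ≈⟨ ℚᵘ.*≡* numerators ⟩
  ℚᵘ.mkℚᵘ (+ a) 0 ℚᵘ.+ ℚᵘ.mkℚᵘ (+ b) 0  ≈⟨ ℚᵘ.+-cong (toℚᵘ-ℕ→ℚ a) (toℚᵘ-ℕ→ℚ b) ⟨
  toℚᵘ (ℕ→ℚ a) ℚᵘ.+ toℚᵘ (ℕ→ℚ b)        ≈⟨ toℚᵘ-homo-+ (ℕ→ℚ a) (ℕ→ℚ b) ⟨
  toℚᵘ (ℕ→ℚ a + ℕ→ℚ b)                  ∎)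
  where
  open ℚᵘ.≃-Reasoning
  toℚᵘ-ℕ→ℚ : ∀ k → toℚᵘ (ℕ→ℚ k) ℚᵘ.≃ ℚᵘ.mkℚᵘ (+ k) 0
  toℚᵘ-ℕ→ℚ k = ℚᵘ.≃-reflexive (cong toℚᵘ (ℕ→ℚ≡mkℚ k))
  numerators : + (a ℕ.+ b) ℤ.* + 1 ≡ (+ a ℤ.* + 1 ℤ.+ + b ℤ.* + 1) ℤ.* + 1
  numerators = cong (ℤ._* + 1)
    (trans (ℤ.pos-+ a b) (sym (cong₂ ℤ._+_ (ℤ.*-identityʳ (+ a)) (ℤ.*-identityʳ (+ b)))))

p≤∣p∣ : ∀ p → p ≤ ∣ p ∣
p≤∣p∣ (mkℚ (+ _) _ _) = ≤-refl
p≤∣p∣ p@(mkℚ -[1+ _ ] _ _) = <⇒≤ (neg<pos p ∣ p ∣)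

-p≤∣p∣ : ∀ p → - p ≤ ∣ p ∣
-p≤∣p∣ p = subst (- p ≤_) (∣-p∣≡∣p∣ p) (p≤∣p∣ (- p))

p-q-[r-s]≤∣q-p-s+r∣ : ∀ p q r s → (p - q) - (r - s) ≤ ∣ q - p - s + r ∣
p-q-[r-s]≤∣q-p-s+r∣ p q r s = subst (_≤ ∣ q - p - s + r ∣)
  (solve 4 (λ p q r s → :- (q :- p :- s :+ r) := (p :- q) :- (r :- s)) refl p q r s)
  (-p≤∣p∣ (q - p - s + r))

0≤½*p⇒0≤p : ∀ {p} → 0ℚ ≤ ½ * p → 0ℚ ≤ p
0≤½*p⇒0≤p = *-cancelˡ-≤-pos ½

2n≤2n*n : ∀ n → 2 ℕ.* n ℕ.≤ 2 ℕ.* n ℕ.* n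
2n≤2n*n ℕ.zero      = ℕ.z≤n
2n≤2n*n n@(ℕ.suc _) = ℕ.m≤m*n (2 ℕ.* n) n

Γ≡2n*n+2n*n : ∀ n → Γ n ≡ ℕ→ℚ (2 ℕ.* n ℕ.* n) + ℕ→ℚ (2 ℕ.* n ℕ.* n)
Γ≡2n*n+2n*n n =
  trans (cong ℕ→ℚ (4n*n≡2n*n+2n*n n)) (ℕ→ℚ-homo-+ (2 ℕ.* n ℕ.* n) (2 ℕ.* n ℕ.* n))
  where
  4n*n≡2n*n+2n*n : ∀ k → 4 ℕ.* k ℕ.* k ≡ 2 ℕ.* k ℕ.* k ℕ.+ 2 ℕ.* k ℕ.* k
  4n*n≡2n*n+2n*n = solve-∀

Γ*ε′≤Γ*ε-2n*ε : ∀ n {ε ε′} → 0ℚ ≤ ε′ → ε′ ≤ ½ * ε → Γ n * ε′ ≤ Γ n * ε - ℕ→ℚ (2 ℕ.* n) * ε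
Γ*ε′≤Γ*ε-2n*ε n {ε} {ε′} 0≤ε′ ε′≤½ε = begin
  Γ n * ε′                          ≤⟨ *-monoˡ-≤-nonNeg (Γ n) ε′≤½ε ⟩
  Γ n * (½ * ε)                     ≡⟨ cong (_* (½ * ε)) (Γ≡2n*n+2n*n n) ⟩
  (h + h) * (½ * ε)                 ≡⟨ solve 2 (λ h ε → (h :+ h) :* (con ½ :* ε) := (h :+ h) :* ε :- h :* ε)
                                               refl h ε ⟩
  (h + h) * ε - h * ε               ≤⟨ +-monoʳ-≤ ((h + h) * ε) (neg-antimono-≤ (*-monoʳ-≤-nonNeg ε 2n≤h)) ⟩
  (h + h) * ε - ℕ→ℚ (2 ℕ.* n) * ε  ≡⟨ cong (λ γ → γ * ε - ℕ→ℚ (2 ℕ.* n) * ε) (Γ≡2n*n+2n*n n) ⟨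
  Γ n * ε - ℕ→ℚ (2 ℕ.* n) * ε      ∎
  where
  open ≤-Reasoning
  h = ℕ→ℚ (2 ℕ.* n ℕ.* n)
  2n≤h : ℕ→ℚ (2 ℕ.* n) ≤ h
  2n≤h = ℕ→ℚ-mono-≤ (2n≤2n*n n)
  instance
    Γ-nonNeg : NonNegative (Γ n)
    Γ-nonNeg = nonNegative (ℕ→ℚ-mono-≤ {b = 4 ℕ.* n ℕ.* n} ℕ.z≤n)
    ε-nonNeg : NonNegative ε
    ε-nonNeg = nonNegative (0≤½*p⇒0≤p {ε} (≤-trans 0≤ε′ ε′≤½ε))

≤-≤ₑ-trans : ∀ {x y c} → y ≤ x → fin x ≤ₑ c → fin y ≤ₑ c
≤-≤ₑ-trans y≤x (fin≤fin x≤z) = fin≤fin (≤-trans y≤x x≤z)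
≤-≤ₑ-trans _   (_ ≤∞)         = _ ≤∞

⊕-perturb : ∀ c {x p q δ} → fin x ≤ₑ (c ⊕ p) → p - q ≤ δ → fin (x - δ) ≤ₑ (c ⊕ q)
⊕-perturb (fin u) {x} {p} {q} {δ} (fin≤fin x≤u+p) p-q≤δ = fin≤fin (begin
  x - δ              ≤⟨ +-mono-≤ x≤u+p (neg-antimono-≤ p-q≤δ) ⟩
  (u + p) - (p - q)  ≡⟨ solve 3 (λ u p q → (u :+ p) :- (p :- q) := u :+ q) refl u p q ⟩
  u + q              ∎)
  where open ≤-Reasoning
⊕-perturb ∞ _ _ = _ ≤∞

cap-oldArc : ∀ {n} (G : Instance n) {k₁ k₂} (F₁ : Fin k₁ → Fin n × Fin n) (F₂ : Fin k₂ → Fin n × Fin n) e →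
  cap (extend G F₁ F₂) (oldArc G F₁ F₂ e) ≡ cap G e
cap-oldArc G {k₁} {k₂} F₁ F₂ e rewrite splitAt-↑ˡ (m G) e ((k₁ ℕ.+ k₁) ℕ.+ (k₂ ℕ.+ k₂)) = refl

lemma4p3 : ∀ {n : ℕ} (G : Instance n) → WellFormed G →
    ∀ {k₁ k₂ : ℕ} (F₁ : Fin k₁ → Fin n × Fin n) (F₂ : Fin k₂ → Fin n × Fin n) →
    Admissible G F₁ F₂ →
    ∀ (ε ε′ : ℚ) → 0ℚ ≤ ε′ → ε′ ≤ ½ * ε →
    ∀ (f : Assignment G) (f′ : Assignment (extend G F₁ F₂)) →
    EpsOptimal G f ε →
    EpsOptimal (extend G F₁ F₂) f′ ε′ →
    (∀ e → ∣ f e - f (rev G e) - f′ (oldArc G F₁ F₂ e) + f′ (rev (extend G F₁ F₂) (oldArc G F₁ F₂ e)) ∣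
             ≤ ℕ→ℚ (2 Data.Nat.* n) * ε) →
    ∀ e → Abundant G f ε e → Abundant (extend G F₁ F₂) f′ ε′ (oldArc G F₁ F₂ e)
lemma4p3 {n} G _ F₁ F₂ _ ε ε′ 0≤ε′ ε′≤½ε f f′ _ _ close e abd =
  subst (λ c → fin (Γ n * ε′) ≤ₑ (c ⊕ (a′ - b′))) (sym (cap-oldArc G F₁ F₂ e))
    (≤-≤ₑ-trans (Γ*ε′≤Γ*ε-2n*ε n 0≤ε′ ε′≤½ε)
      (⊕-perturb (cap G e) abd (≤-trans (p-q-[r-s]≤∣q-p-s+r∣ a b a′ b′) (close e))))
  where
  a = f (rev G e)
  b = f e
  a′ = f′ (rev (extend G F₁ F₂) (oldArc G F₁ F₂ e))
  b′ = f′ (oldArc G F₁ F₂ e)
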